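{- For every $n\ge 1$ and every $t>0$, there exists a skipless family $\mathcal{F}\subseteq 2^{[n]}$ with $|\mathcal{F}|=\mathrm{La}(n,t)$ such that every component of $G_\mathcal{F}$ has order at most $t$.
   Context: For $\mathcal{F}\subseteq 2^{[n]}$, $G_\mathcal{F}$ is the graph on $\mathcal{F}$ with distinct $A,B$ adjacent iff $A\subseteq B$ or $B\subseteq A$; the order of a component is its number of vertices. $\mathrm{La}(n,t)$ is the largest size of $\mathcal{F}\subseteq 2^{[n]}$ such that every component of $G_\mathcal{F}$ has order at most $t$. A set $Y\subseteq[n]$ is a skip of $\mathcal{F}$ if $Y\notin\mathcal{F}$ and there exist $X,Z\in\mathcal{F}$ with $X\subseteq Y\subseteq Z$; $\mathcal{F}$ is skipless if it has no skip. -}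

module Defs where

open import Data.Nat using (ℕ; _≤_)
open import Data.Product using (Σ; _×_; ∃)
open import Data.Sum using (_⊎_)
open import Data.List using (List; length)
open import Data.List.Relation.Unary.All using (All)
open import Data.List.Relation.Unary.Unique.Propositional using (Unique)
open import Data.List.Membership.Propositional using (_∈_; _∉_)
open import Data.Fin.Subset using (Subset; _⊆_)
open import Relation.Nullary using (¬_)
open import Relation.Binary.PropositionalEquality using (_≡_)

-- A family F ⊆ 2^[n] is a duplicate-free list of subsets of [n] = Fin n;
-- its size |F| is the length of the list.
Family : ℕ → Set
Family n = List (Subset n)

-- Comparability (adjacency in G_F, plus reflexivity, irrelevant for connectivity).
Comparable : ∀ {n} → Subset n → Subset n → Set
Comparable A B = A ⊆ B ⊎ B ⊆ A

data Connected {n} (F : Family n) (A : Subset n) : Subset n → Set where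
  here : A ∈ F → Connected F A A
  step : ∀ {B C} → Connected F A B → C ∈ F → Comparable B C → Connected F A C

-- Every component of G_F has order at most t: for every vertex A, any
-- collection of distinct vertices in the component of A has at most t elements.
ComponentsAtMost : ∀ {n} → ℕ → Family n → Set
ComponentsAtMost {n} t F =
  ∀ (A : Subset n) → A ∈ F →
  ∀ (L : List (Subset n)) → Unique L → All (Connected F A) L → length L ≤ t

Admissible : ∀ n → ℕ → Family n → Set
Admissible n t F = Unique F × ComponentsAtMost t F

IsLa : ℕ → ℕ → ℕ → Set
IsLa n t m =
  (Σ (Family n) λ F → Admissible n t F × length F ≡ m)
  × (∀ (F : Family n) → Admissible n t F → length F ≤ m)

Skip : ∀ {n} → Family n → Subset n → Set
Skip {n} F Y = Y ∉ F × Σ (Subset n) λ X → Σ (Subset n) λ Z → X ∈ F × Z ∈ F × X ⊆ Y × Y ⊆ Z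

Skipless : ∀ {n} → Family n → Set
Skipless {n} F = ∀ (Y : Subset n) → ¬ Skip F Y

{-# OPTIONS --safe #-}
-- If Y is a skip of F, witnessed by X ⊆ Y ⊆ Z with X, Z ∈ F,
-- replace Z by Y.  The family stays duplicate-free and keeps its size, and no
-- component grows: exchanging Y and Z maps every component of the new family
-- injectively into a component of the old one, because an edge between B and
-- Y becomes the edge B ⊆ Y ⊆ Z if B ⊆ Y, and the path Z ⊇ X ⊆ B if Y ⊆ B.
-- Since the total size Σ_{A ∈ F} |A| strictly decreases, iterating ends in a
-- skipless family.  So every admissible family can be made skipless without
-- changing its size: only the existence of an admissible family of size
-- La(n,t) is used, not its maximality, nor n ≥ 1 or t > 0.
module Submission where

open import Defs
open import Data.Nat using (ℕ; _≤_; _<_; s≤s)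
open import Data.Nat.Properties using (≤-refl; ≤-reflexive; +-mono-≤; +-mono-<-≤; +-mono-≤-<)
open import Data.Nat.ListAction using (sum)
open import Data.Nat.Induction using (<-wellFounded)
open import Induction.WellFounded using (Acc; acc)
open import Data.Product using (Σ; _×_; _,_)
import Data.Sum as Sum
open import Data.Sum using (inj₁; inj₂)
import Data.Bool as Bool
open import Data.List using (List; length; map)
open import Data.List.Properties using (length-map; map-∘)
open import Data.List.Relation.Unary.All using (All; []; _∷_)
import Data.List.Relation.Unary.All as All
import Data.List.Relation.Unary.All.Properties as All
open import Data.List.Relation.Unary.Any using (Any; here; there; any?)
open import Data.List.Relation.Unary.Unique.Propositional using (Unique)
import Data.List.Relation.Unary.Unique.Propositional.Properties as Unique
open import Data.List.Membership.Propositional using (_∈_; _∉_; find; lose)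
open import Data.List.Membership.Propositional.Properties using (∈-map⁻)
open import Data.Fin.Subset using (Subset; _⊆_; ∣_∣; inside; outside)
open import Data.Fin.Subset.Properties using (_⊆?_; ⊆-trans; drop-∷-⊆; p⊆q⇒∣p∣≤∣q∣; anySubset?)
open import Data.Vec using (_∷_)
import Data.Vec as Vec
open import Data.Vec.Properties using (≡-dec)
open import Relation.Binary.Definitions using (DecidableEquality)
open import Relation.Nullary using (Dec; yes; no; ¬?; contradiction)
import Relation.Nullary.Decidable as Dec
open import Relation.Binary.PropositionalEquality using (_≡_; _≢_; refl; sym; trans; cong; subst)
open import Function using (_∘_)

module Transposition {a} {A : Set a} (_≟_ : DecidableEquality A) where

  swap : A → A → A → A
  swap x y z with z ≟ x | z ≟ y
  ... | yes _ | _     = y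
  ... | no _  | yes _ = x
  ... | no _  | no _  = z

  swap-left : ∀ x y → swap x y x ≡ y
  swap-left x y with x ≟ x
  ... | yes _  = refl
  ... | no x≢x = contradiction refl x≢x

  swap-right : ∀ x y → swap x y y ≡ x
  swap-right x y with y ≟ x | y ≟ y
  ... | yes y≡x | _      = y≡x
  ... | no _    | yes _  = refl
  ... | no _    | no y≢y = contradiction refl y≢y

  swap-other : ∀ {x y z} → z ≢ x → z ≢ y → swap x y z ≡ z
  swap-other {x} {y} {z} z≢x z≢y with z ≟ x | z ≟ y
  ... | yes z≡x | _       = contradiction z≡x z≢x
  ... | no _    | yes z≡y = contradiction z≡y z≢y
  ... | no _    | no _    = refl

  swap-involutive : ∀ x y z → swap x y (swap x y z) ≡ z
  swap-involutive x y z with z ≟ x | z ≟ y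
  ... | yes refl | _        = swap-right z y
  ... | no _     | yes refl = swap-left x z
  ... | no z≢x   | no z≢y   = swap-other z≢x z≢y

  swap-injective : ∀ x y {z w} → swap x y z ≡ swap x y w → z ≡ w
  swap-injective x y {z} {w} eq =
    trans (sym (swap-involutive x y z)) (trans (cong (swap x y) eq) (swap-involutive x y w))

sum-map-≤ : ∀ {a} {A : Set a} (f g : A → ℕ) {xs : List A} →
            All (λ x → f x ≤ g x) xs → sum (map f xs) ≤ sum (map g xs)
sum-map-≤ f g []           = ≤-refl
sum-map-≤ f g (fx≤gx ∷ ≤s) = +-mono-≤ fx≤gx (sum-map-≤ f g ≤s)

sum-map-< : ∀ {a} {A : Set a} (f g : A → ℕ) {xs : List A} →
            All (λ x → f x ≤ g x) xs → Any (λ x → f x < g x) xs →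
            sum (map f xs) < sum (map g xs)
sum-map-< f g (_ ∷ ≤s)     (here fx<gx) = +-mono-<-≤ fx<gx (sum-map-≤ f g ≤s)
sum-map-< f g (fx≤gx ∷ ≤s) (there <s)   = +-mono-≤-< fx≤gx (sum-map-< f g ≤s <s)

_≟ₛ_ : ∀ {n} → DecidableEquality (Subset n)
_≟ₛ_ = ≡-dec Bool._≟_

p⊆q⇒p≢q⇒∣p∣<∣q∣ : ∀ {n} {p q : Subset n} → p ⊆ q → p ≢ q → ∣ p ∣ < ∣ q ∣
p⊆q⇒p≢q⇒∣p∣<∣q∣ {p = Vec.[]}      {Vec.[]}      _   p≢q = contradiction refl p≢q
p⊆q⇒p≢q⇒∣p∣<∣q∣ {p = outside ∷ p} {outside ∷ q} p⊆q p≢q =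
  p⊆q⇒p≢q⇒∣p∣<∣q∣ (drop-∷-⊆ p⊆q) (p≢q ∘ cong (outside ∷_))
p⊆q⇒p≢q⇒∣p∣<∣q∣ {p = outside ∷ p} {inside ∷ q}  p⊆q _   = s≤s (p⊆q⇒∣p∣≤∣q∣ (drop-∷-⊆ p⊆q))
p⊆q⇒p≢q⇒∣p∣<∣q∣ {p = inside ∷ p}  {outside ∷ q} p⊆q _   = contradiction (p⊆q Vec.here) λ ()
p⊆q⇒p≢q⇒∣p∣<∣q∣ {p = inside ∷ p}  {inside ∷ q}  p⊆q p≢q =
  s≤s (p⊆q⇒p≢q⇒∣p∣<∣q∣ (drop-∷-⊆ p⊆q) (p≢q ∘ cong (inside ∷_)))

weight : ∀ {n} → Family n → ℕ
weight F = sum (map ∣_∣ F)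

skip? : ∀ {n} (F : Family n) (Y : Subset n) → Dec (Skip F Y)
skip? F Y =
  Dec.map′ fromAny toAny (¬? (Y ∈? F) Dec.×-dec (any? (_⊆? Y) F Dec.×-dec any? (Y ⊆?_) F))
  where
  open import Data.List.Membership.DecPropositional _≟ₛ_ using (_∈?_)
  fromAny : Y ∉ F × Any (_⊆ Y) F × Any (Y ⊆_) F → Skip F Y
  fromAny (Y∉F , below , above) with find below | find above
  ... | X , X∈F , X⊆Y | Z , Z∈F , Y⊆Z = Y∉F , X , Z , X∈F , Z∈F , X⊆Y , Y⊆Z
  toAny : Skip F Y → Y ∉ F × Any (_⊆ Y) F × Any (Y ⊆_) F
  toAny (Y∉F , X , Z , X∈F , Z∈F , X⊆Y , Y⊆Z) = Y∉F , lose X∈F X⊆Y , lose Z∈F Y⊆Z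

module _ {n} {F : Family n} where

  Connected-∈ : ∀ {A B} → Connected F A B → B ∈ F
  Connected-∈ (here A∈F)     = A∈F
  Connected-∈ (step _ C∈F _) = C∈F

  Connected-trans : ∀ {A B C} → Connected F A B → Connected F B C → Connected F A C
  Connected-trans A~B (here _)           = A~B
  Connected-trans A~B (step B~C D∈F C≶D) = step (Connected-trans A~B B~C) D∈F C≶D

  Connected-sym : ∀ {A B} → Connected F A B → Connected F B A
  Connected-sym (here A∈F)         = here A∈F
  Connected-sym (step A~B C∈F B≶C) =
    Connected-trans (step (here C∈F) (Connected-∈ A~B) (Sum.swap B≶C)) (Connected-sym A~B)

Connected-map : ∀ {n} {G H : Family n} (f : Subset n → Subset n) →
                (∀ {B} → B ∈ G → f B ∈ H) →
                (∀ {B C} → B ∈ G → C ∈ G → Comparable B C → Connected H (f B) (f C)) →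
                ∀ {A B} → Connected G A B → Connected H (f A) (f B)
Connected-map f f-∈ f-edge (here A∈G)         = here (f-∈ A∈G)
Connected-map f f-∈ f-edge (step A~B C∈G B≶C) =
  Connected-trans (Connected-map f f-∈ f-edge A~B) (f-edge (Connected-∈ A~B) C∈G B≶C)

ComponentsAtMost-embed : ∀ {n t} {G H : Family n} (f : Subset n → Subset n) →
                         (∀ {B C} → f B ≡ f C → B ≡ C) →
                         (∀ {A B} → Connected G A B → Connected H (f A) (f B)) →
                         ComponentsAtMost t H → ComponentsAtMost t G
ComponentsAtMost-embed {t = t} f f-injective f-connected H≤t A A∈G L uniqueL A~L =
  subst (_≤ t) (length-map f L)
    (H≤t (f A) (Connected-∈ (f-connected (here A∈G))) (map f L)
      (Unique.map⁺ f-injective uniqueL) (All.map⁺ (All.map f-connected A~L)))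

module Compression {n} {F : Family n} {X Y Z : Subset n}
                   (Y∉F : Y ∉ F) (X∈F : X ∈ F) (Z∈F : Z ∈ F) (X⊆Y : X ⊆ Y) (Y⊆Z : Y ⊆ Z) where

  open Transposition (_≟ₛ_ {n})

  exchange : Subset n → Subset n
  exchange = swap Y Z

  F′ : Family n
  F′ = map exchange F

  Y≢Z : Y ≢ Z
  Y≢Z refl = Y∉F Z∈F

  exchange-∈ : ∀ {B} → B ∈ F′ → exchange B ∈ F
  exchange-∈ B∈F′ with ∈-map⁻ exchange B∈F′
  ... | C , C∈F , refl = subst (_∈ F) (sym (swap-involutive Y Z C)) C∈F

  Z∉F′ : Z ∉ F′
  Z∉F′ Z∈F′ = Y∉F (subst (_∈ F) (swap-right Y Z) (exchange-∈ Z∈F′))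

  exchange-fixes-F′ : ∀ {B} → B ∈ F′ → Y ≢ B → exchange B ≡ B
  exchange-fixes-F′ B∈F′ Y≢B = swap-other (Y≢B ∘ sym) λ { refl → Z∉F′ B∈F′ }

  ∈-F′⇒∈-F : ∀ {B} → B ∈ F′ → Y ≢ B → B ∈ F
  ∈-F′⇒∈-F B∈F′ Y≢B = subst (_∈ F) (exchange-fixes-F′ B∈F′ Y≢B) (exchange-∈ B∈F′)

  Z-connected : ∀ {C} → C ∈ F → Comparable Y C → Connected F Z C
  Z-connected C∈F (inj₁ Y⊆C) =
    step (step (here Z∈F) X∈F (inj₂ (⊆-trans X⊆Y Y⊆Z))) C∈F (inj₁ (⊆-trans X⊆Y Y⊆C))
  Z-connected C∈F (inj₂ C⊆Y) = step (here Z∈F) C∈F (inj₂ (⊆-trans C⊆Y Y⊆Z))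

  exchange-edge : ∀ {B C} → B ∈ F′ → C ∈ F′ → Comparable B C →
                  Connected F (exchange B) (exchange C)
  exchange-edge {B} {C} B∈F′ C∈F′ B≶C with Y ≟ₛ B | Y ≟ₛ C
  ... | yes refl | yes refl = here (exchange-∈ B∈F′)
  ... | yes refl | no Y≢C
    rewrite swap-left Y Z | exchange-fixes-F′ C∈F′ Y≢C =
      Z-connected (∈-F′⇒∈-F C∈F′ Y≢C) B≶C
  ... | no Y≢B   | yes refl
    rewrite swap-left Y Z | exchange-fixes-F′ B∈F′ Y≢B =
      Connected-sym (Z-connected (∈-F′⇒∈-F B∈F′ Y≢B) (Sum.swap B≶C))
  ... | no Y≢B   | no Y≢C
    rewrite exchange-fixes-F′ B∈F′ Y≢B | exchange-fixes-F′ C∈F′ Y≢C =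
      step (here (∈-F′⇒∈-F B∈F′ Y≢B)) (∈-F′⇒∈-F C∈F′ Y≢C) B≶C

  admissible : ∀ {t} → Admissible n t F → Admissible n t F′
  admissible (uniqueF , F≤t) =
    Unique.map⁺ (swap-injective Y Z) uniqueF ,
    ComponentsAtMost-embed exchange (swap-injective Y Z)
      (Connected-map exchange exchange-∈ exchange-edge) F≤t

  length-F′ : length F′ ≡ length F
  length-F′ = length-map exchange F

  ∣exchange∣≤ : ∀ {B} → B ∈ F → ∣ exchange B ∣ ≤ ∣ B ∣
  ∣exchange∣≤ {B} B∈F with Z ≟ₛ B
  ... | yes refl = subst (λ W → ∣ W ∣ ≤ ∣ Z ∣) (sym (swap-right Y Z)) (p⊆q⇒∣p∣≤∣q∣ Y⊆Z)
  ... | no Z≢B   = ≤-reflexive (cong ∣_∣ (swap-other (λ { refl → Y∉F B∈F }) (Z≢B ∘ sym)))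

  weight-F′< : weight F′ < weight F
  weight-F′< =
    subst (_< weight F) (cong sum (map-∘ F))
      (sum-map-< (∣_∣ ∘ exchange) ∣_∣ (All.tabulate ∣exchange∣≤)
        (lose Z∈F (subst (λ W → ∣ W ∣ < ∣ Z ∣) (sym (swap-right Y Z)) (p⊆q⇒p≢q⇒∣p∣<∣q∣ Y⊆Z Y≢Z))))

skipless-admissible : ∀ {n t} (F : Family n) → Acc _<_ (weight F) → Admissible n t F →
                      Σ (Family n) λ G → Admissible n t G × Skipless G × length G ≡ length F
skipless-admissible F (acc smaller) admF with anySubset? (skip? F)
... | no ∄skip = F , admF , (λ Y skip → ∄skip (Y , skip)) , refl
... | yes (Y , Y∉F , X , Z , X∈F , Z∈F , X⊆Y , Y⊆Z) =
  let open Compression Y∉F X∈F Z∈F X⊆Y Y⊆Z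
      G , admG , skiplessG , ∣G∣≡∣F′∣ = skipless-admissible F′ (smaller weight-F′<) (admissible admF)
  in G , admG , skiplessG , trans ∣G∣≡∣F′∣ length-F′

lemma2p3 : ∀ (n t : ℕ) → 1 ≤ n → 0 < t → ∀ (m : ℕ) → IsLa n t m →
    Σ (Family n) λ F → Unique F × Skipless F × length F ≡ m × ComponentsAtMost t F
lemma2p3 n t _ _ m ((F , admF , ∣F∣≡m) , _) =
  let G , (uniqueG , G≤t) , skiplessG , ∣G∣≡∣F∣ = skipless-admissible F (<-wellFounded _) admF
  in G , uniqueG , skiplessG , trans ∣G∣≡∣F∣ ∣F∣≡m , G≤t
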